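{- Let $p\ge1$, let $1\leq r_1\leq r_2\leq\cdots\leq r_p$ be integers, $\mathbf r_p=(r_1,\dots,r_p)$, $|\mathbf r_p|=r_1+\cdots+r_p$, and $n\ge0$. Then, as polynomials in $z$, \[ z^{n+p}(z-1)^{|\mathbf r_p|-p}=\sum_{k=0}^{n+|\mathbf r_p|}{n+|\mathbf r_p| \brace k}_{\!T(\mathbf r_p)}(z)_k . \] Furthermore, for all $k$, \[ {n+|\mathbf r_p| \brace k}_{\!T(\mathbf r_p)}={n+|\mathbf r_p| \brace k}_{\!T(|\mathbf r_p|-p+1)}. \]
   Context: $(z)_k=z(z-1)\cdots(z-k+1)$, $(z)_0=1$. For integers $N\ge0$ and $r_1,\dots,r_p$ with $\sum r_i\le N$, let $R_1,\dots,R_p$ be pairwise disjoint subsets of $\{1,\dots,N\}$ with $|R_i|=r_i$; the $T(r_1,\dots,r_p)$-Stirling number of the second kind ${N\brace k}_{T(r_1,\dots,r_p)}$ is the number of partitions of $\{1,\dots,N\}$ into $k$ nonempty blocks such that, for each $i$, the minimum element of $R_i$ is not in the same block as any other element of $R_i$ (independent of the choice of the $R_i$). For $p=1$ and a single integer $m$, ${N\brace k}_{T(m)}$ is the case of one set $R_1$ of size $m$. -}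

module Defs where

open import Data.Nat using (ℕ; zero; suc)
open import Data.Fin using (Fin; _<_; _≤_)
open import Data.Fin.Properties using (_≟_; _<?_; _≤?_; all?; any?)
open import Data.Fin.Subset using (Subset; _∈_)
open import Data.Fin.Subset.Properties using (_∈?_)
open import Data.Vec using (Vec; []; _∷_; lookup)
open import Data.List using (List; [_]; concatMap; map; allFin; filter; length)
open import Data.Product using (∃; _×_)
open import Data.Integer as ℤ using (ℤ; +_)
open import Relation.Binary.PropositionalEquality using (_≡_; _≢_)
open import Relation.Nullary using (Dec; ¬_)
open import Relation.Nullary.Decidable using (_×-dec_; _→-dec_; ¬?)

-- A set partition of {1,…,N} (here Fin N) into k nonempty blocks is encoded
-- by its canonical block labelling f : Fin N → Fin k: f is surjective (all k
-- blocks nonempty) and blocks are labelled in increasing order of their least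
-- elements (every label smaller than f x already occurs before x).
-- This is a bijection between set partitions into k blocks and such labellings.

IsCanonical : ∀ {N k} → (Fin N → Fin k) → Set
IsCanonical {N} {k} f = ∀ (x : Fin N) (j : Fin k) → j < f x → ∃ λ y → y < x × f y ≡ j

IsSurjective : ∀ {N k} → (Fin N → Fin k) → Set
IsSurjective {N} {k} f = ∀ (j : Fin k) → ∃ λ (x : Fin N) → f x ≡ j

MinSeparated : ∀ {N k} → (Fin N → Fin k) → Subset N → Set
MinSeparated {N} f S =
  ∀ (x : Fin N) → x ∈ S → (∀ y → y ∈ S → x ≤ y) →
  ∀ (y : Fin N) → y ∈ S → ¬ (y ≡ x) → ¬ (f y ≡ f x)

Admissible : ∀ {N k p} → (Fin p → Subset N) → (Fin N → Fin k) → Set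
Admissible R f = IsCanonical f × IsSurjective f × (∀ i → MinSeparated f (R i))

admissible? : ∀ {N k p} (R : Fin p → Subset N) (f : Fin N → Fin k) → Dec (Admissible R f)
admissible? R f =
  (all? λ x → all? λ j → (j <? f x) →-dec any? (λ y → (y <? x) ×-dec (f y ≟ j)))
  ×-dec ((all? λ j → any? λ x → f x ≟ j)
  ×-dec (all? λ i → all? λ x → (x ∈? R i) →-dec
           ((all? λ y → (y ∈? R i) →-dec (x ≤? y)) →-dec
            (all? λ y → (y ∈? R i) →-dec (¬? (y ≟ x) →-dec ¬? (f y ≟ f x))))))

allVecs : ∀ k N → List (Vec (Fin k) N)
allVecs k zero = [ [] ]
allVecs k (suc N) = concatMap (λ i → map (i ∷_) (allVecs k N)) (allFin k)

StirlingT : (N k : ℕ) {p : ℕ} → (Fin p → Subset N) → ℕ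
StirlingT N k R = length (filter (λ v → admissible? R (lookup v)) (allVecs k N))

falling : ℤ → ℕ → ℤ
falling z zero = + 1
falling z (suc k) = falling z k ℤ.* (z ℤ.- + k)

sumTo : ℕ → (ℕ → ℤ) → ℤ
sumTo zero f = f 0
sumTo (suc n) f = sumTo n f ℤ.+ f (suc n)

total : ∀ {p} → (Fin p → ℕ) → ℕ
total {zero} r = 0
total {suc p} r = r Fin.zero Data.Nat.+ total (λ i → r (Fin.suc i))
  where import Data.Fin as Fin

-- A restriction such as T(R₁,…,R_p) forbids certain points y to share a block with an
-- earlier "leader" x, each point having at most one leader. Building a canonical labelling
-- point by point, the last point either joins one of the k + 1 existing blocks other than
-- that of its leader, or opens a new block; hence S(N+1, k+1) = (k+1−δ) S(N, k+1) + S(N, k),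
-- with δ = 1 if the last point has a leader and δ = 0 otherwise. Since (z)ₖ₊₁ = (z)ₖ (z − k),
-- this recurrence says F_{N+1}(z) = F_N(z) (z − δ) for F_N(z) = Σₖ S(N, k) (z)ₖ, so
-- F_N(z) = z^(N−B) (z−1)^B where B counts the points with a leader. For T(r₁,…,r_p) these are
-- the non-minimal elements of the Rᵢ, so B = |r| − p, and likewise for the single set
-- T(|r|−p+1). The falling factorials are linearly independent as functions on ℕ, so equal
-- polynomials have equal coefficients.

module Submission where

open import Defs
open import Algebra.Bundles using (AbelianGroup)
open import Data.Bool using (true; false; if_then_else_)
open import Data.Fin as F using (Fin; zero; suc; inject₁; fromℕ; toℕ)
open import Data.Fin.Properties as FP using (_≟_; _≤?_; any?; all?)
open import Data.Fin.Relation.Unary.Top using (view; ‵fromℕ; ‵inject₁)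
open import Data.Fin.Subset using (Subset; _∈_; _∉_; ∣_∣)
open import Data.Fin.Subset.Properties using (_∈?_)
open import Data.Integer as ℤ using (ℤ; +_; _*_; _-_; _^_)
import Data.Integer.Properties as ℤP
open import Data.Integer.Tactic.RingSolver using (solve-∀)
open import Data.List as List using (List; filter; length)
import Data.List.Properties as ListP
open import Data.Nat as ℕ using (ℕ; _+_; _∸_)
import Data.Nat.Properties as ℕP
open import Data.Product using (∃; _×_; _,_; proj₁; proj₂)
open import Data.Vec as Vec using (here; there)
open import Data.Vec.Functional using (_∷_)
open import Function using (_∘_; _⇔_; mk⇔; Equivalence; case_of_)
open import Relation.Binary.Core using (_Preserves_⟶_)
open import Relation.Binary.PropositionalEquality
open import Relation.Nullary using (Dec; yes; no; does; ¬_; contradiction)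
open import Relation.Nullary.Decidable using (_×-dec_; _→-dec_; ¬?)
open import Relation.Unary using (Pred; Decidable)

open import Algebra.Properties.Semiring.Sum ℕP.+-*-semiring
  using (sum-syntax; sum-cong-≗; sum-init-last; sum-replicate-zero; ∑-distrib-+; ∑-comm; *-distribˡ-sum)
open import Algebra.Properties.Group (AbelianGroup.group ℤP.+-0-abelianGroup)
  using (∙-cancelˡ)

-- Indicators and finite sums

-- Through does, so that 𝟙 computes through Dec.map′ (as used by _∈?_).
𝟙 : ∀ {a} {P : Set a} → Dec P → ℕ
𝟙 P? = if does P? then 1 else 0

module _ {a b} {P : Set a} {Q : Set b} where

  𝟙-cong : P ⇔ Q → (P? : Dec P) (Q? : Dec Q) → 𝟙 P? ≡ 𝟙 Q?
  𝟙-cong P⇔Q (yes p) (yes q) = refl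
  𝟙-cong P⇔Q (yes p) (no ¬q) = contradiction (Equivalence.to P⇔Q p) ¬q
  𝟙-cong P⇔Q (no ¬p) (yes q) = contradiction (Equivalence.from P⇔Q q) ¬p
  𝟙-cong P⇔Q (no ¬p) (no ¬q) = refl

  𝟙-× : (P? : Dec P) (Q? : Dec Q) → 𝟙 (P? ×-dec Q?) ≡ 𝟙 P? ℕ.* 𝟙 Q?
  𝟙-× (yes p) (yes q) = refl
  𝟙-× (yes p) (no ¬q) = refl
  𝟙-× (no ¬p) Q? = refl

module _ {a} {P : Set a} where

  𝟙-yes : P → (P? : Dec P) → 𝟙 P? ≡ 1
  𝟙-yes p (yes _) = refl
  𝟙-yes p (no ¬p) = contradiction p ¬p

  𝟙-no : ¬ P → (P? : Dec P) → 𝟙 P? ≡ 0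
  𝟙-no ¬p (yes p) = contradiction p ¬p
  𝟙-no ¬p (no _) = refl

  𝟙≤1 : (P? : Dec P) → 𝟙 P? ℕ.≤ 1
  𝟙≤1 (yes _) = ℕ.s≤s ℕ.z≤n
  𝟙≤1 (no _) = ℕ.z≤n

∑-1 : ∀ n → ∑[ i < n ] 1 ≡ n
∑-1 ℕ.zero = refl
∑-1 (ℕ.suc n) = cong ℕ.suc (∑-1 n)

∑-zero : ∀ n {f : Fin n → ℕ} → (∀ i → f i ≡ 0) → ∑[ i < n ] f i ≡ 0
∑-zero n f≗0 = trans (sum-cong-≗ f≗0) (sum-replicate-zero n)

∑-𝟙-≡ : ∀ {n} (j : Fin n) → ∑[ i < n ] 𝟙 (i ≟ j) ≡ 1
∑-𝟙-≡ {ℕ.suc n} zero = cong ℕ.suc (∑-zero n λ i → 𝟙-no (λ ()) (suc i ≟ zero))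
∑-𝟙-≡ {ℕ.suc n} (suc j) =
  trans (sum-cong-≗ λ i → 𝟙-cong (mk⇔ FP.suc-injective (cong suc)) (suc i ≟ suc j) (i ≟ j)) (∑-𝟙-≡ j)

∑-𝟙-≢ : ∀ {n} (j : Fin (ℕ.suc n)) → ∑[ i < ℕ.suc n ] 𝟙 (¬? (i ≟ j)) ≡ n
∑-𝟙-≢ {n} zero = trans (sum-cong-≗ {n} λ i → 𝟙-yes (λ ()) (¬? (suc i ≟ zero))) (∑-1 n)
∑-𝟙-≢ {ℕ.suc n} (suc j) = cong ℕ.suc (trans
  (sum-cong-≗ λ i → 𝟙-cong (mk⇔ (_∘ cong suc) (_∘ FP.suc-injective)) (¬? (suc i ≟ suc j)) (¬? (i ≟ j)))
  (∑-𝟙-≢ j))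

∑-𝟙-∈ : ∀ {n} (S : Subset n) → ∑[ y < n ] 𝟙 (y ∈? S) ≡ ∣ S ∣
∑-𝟙-∈ Vec.[] = refl
∑-𝟙-∈ (true Vec.∷ S) = cong ℕ.suc (∑-𝟙-∈ S)
∑-𝟙-∈ (false Vec.∷ S) = ∑-𝟙-∈ S

∑-𝟙-∈-≢ : ∀ {n} (S : Subset n) {m} → m ∈ S → ∑[ y < n ] 𝟙 (y ∈? S ×-dec ¬? (y ≟ m)) + 1 ≡ ∣ S ∣
∑-𝟙-∈-≢ {n} S {m} m∈S = begin
  ∑[ y < n ] 𝟙 (y ∈? S ×-dec ¬? (y ≟ m)) + 1
    ≡⟨ cong (λ t → ∑[ y < n ] 𝟙 (y ∈? S ×-dec ¬? (y ≟ m)) + t) (sym (∑-𝟙-≡ m)) ⟩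
  ∑[ y < n ] 𝟙 (y ∈? S ×-dec ¬? (y ≟ m)) + ∑[ y < n ] 𝟙 (y ≟ m)
    ≡⟨ sym (∑-distrib-+ (λ y → 𝟙 (y ∈? S ×-dec ¬? (y ≟ m))) (λ y → 𝟙 (y ≟ m))) ⟩
  ∑[ y < n ] (𝟙 (y ∈? S ×-dec ¬? (y ≟ m)) + 𝟙 (y ≟ m))
    ≡⟨ sum-cong-≗ split ⟩
  ∑[ y < n ] 𝟙 (y ∈? S)
    ≡⟨ ∑-𝟙-∈ S ⟩
  ∣ S ∣ ∎
  where
  open ≡-Reasoning
  split : ∀ y → 𝟙 (y ∈? S ×-dec ¬? (y ≟ m)) + 𝟙 (y ≟ m) ≡ 𝟙 (y ∈? S)
  split y with y ∈? S | y ≟ m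
  ... | yes _ | yes _ = refl
  ... | yes _ | no _ = refl
  ... | no _ | no _ = refl
  ... | no y∉S | yes refl = contradiction m∈S y∉S

𝟙-any?-unique : ∀ {n ℓ} {P : Pred (Fin n) ℓ} (P? : Decidable P) → (∀ {i j} → P i → P j → i ≡ j) →
                𝟙 (any? P?) ≡ ∑[ i < n ] 𝟙 (P? i)
𝟙-any?-unique {ℕ.zero} P? unique = refl
𝟙-any?-unique {ℕ.suc n} P? unique with P? zero
... | yes p = cong ℕ.suc (sym (∑-zero n λ i → 𝟙-no (λ q → FP.0≢1+n (unique p q)) (P? (suc i))))
... | no _ = 𝟙-any?-unique (P? ∘ suc) λ p q → FP.suc-injective (unique p q)

∑-𝟙≤ : ∀ {n ℓ} {P : Pred (Fin n) ℓ} (P? : Decidable P) → ∑[ i < n ] 𝟙 (P? i) ℕ.≤ n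
∑-𝟙≤ {ℕ.zero} P? = ℕ.z≤n
∑-𝟙≤ {ℕ.suc n} P? = ℕP.+-mono-≤ (𝟙≤1 (P? zero)) (∑-𝟙≤ (P? ∘ suc))

-- Sums over all maps Fin N → Fin k

sumMaps : ∀ k N → ((Fin N → Fin k) → ℕ) → ℕ
sumMaps k ℕ.zero w = w (λ ())
sumMaps k (ℕ.suc N) w = ∑[ i < k ] sumMaps k N (λ g → w (i ∷ g))

module _ {k : ℕ} where

  sumMaps-cong : ∀ N {w w′ : (Fin N → Fin k) → ℕ} → (∀ g → w g ≡ w′ g) → sumMaps k N w ≡ sumMaps k N w′
  sumMaps-cong ℕ.zero w≗w′ = w≗w′ _
  sumMaps-cong (ℕ.suc N) w≗w′ = sum-cong-≗ λ i → sumMaps-cong N (w≗w′ ∘ (i ∷_))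

  sumMaps-zero : ∀ N {w : (Fin N → Fin k) → ℕ} → (∀ g → w g ≡ 0) → sumMaps k N w ≡ 0
  sumMaps-zero ℕ.zero w≗0 = w≗0 _
  sumMaps-zero (ℕ.suc N) w≗0 = ∑-zero k λ i → sumMaps-zero N (w≗0 ∘ (i ∷_))

  sumMaps-+ : ∀ N (w w′ : (Fin N → Fin k) → ℕ) → sumMaps k N (λ g → w g + w′ g) ≡ sumMaps k N w + sumMaps k N w′
  sumMaps-+ ℕ.zero w w′ = refl
  sumMaps-+ (ℕ.suc N) w w′ =
    trans (sum-cong-≗ {k} λ i → sumMaps-+ N _ _) (∑-distrib-+ (λ i → sumMaps k N (w ∘ (i ∷_))) _)

  sumMaps-*ˡ : ∀ N c (w : (Fin N → Fin k) → ℕ) → sumMaps k N (λ g → c ℕ.* w g) ≡ c ℕ.* sumMaps k N w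
  sumMaps-*ˡ ℕ.zero c w = refl
  sumMaps-*ˡ (ℕ.suc N) c w =
    trans (sum-cong-≗ {k} λ i → sumMaps-*ˡ N c _) (sym (*-distribˡ-sum c λ i → sumMaps k N (w ∘ (i ∷_))))

∷-preserves-≗ : ∀ {N k} {w : (Fin (ℕ.suc N) → Fin k) → ℕ} → w Preserves _≗_ ⟶ _≡_ →
                ∀ i → (λ g → w (i ∷ g)) Preserves _≗_ ⟶ _≡_
∷-preserves-≗ w-≗ i g≗h = w-≗ λ { zero → refl ; (suc x) → g≗h x }

infixl 5 _∷ʳ_

_∷ʳ_ : ∀ {A : Set} {N} → (Fin N → A) → A → Fin (ℕ.suc N) → A
_∷ʳ_ {N = ℕ.zero} g a _ = a
_∷ʳ_ {N = ℕ.suc N} g a zero = g zero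
_∷ʳ_ {N = ℕ.suc N} g a (suc x) = (g ∘ suc ∷ʳ a) x

module _ {A : Set} where

  init-∷ʳ : ∀ {N} (g : Fin N → A) a x → (g ∷ʳ a) (inject₁ x) ≡ g x
  init-∷ʳ {ℕ.suc N} g a zero = refl
  init-∷ʳ {ℕ.suc N} g a (suc x) = init-∷ʳ (g ∘ suc) a x

  last-∷ʳ : ∀ {N} (g : Fin N → A) a → (g ∷ʳ a) (fromℕ N) ≡ a
  last-∷ʳ {ℕ.zero} g a = refl
  last-∷ʳ {ℕ.suc N} g a = last-∷ʳ (g ∘ suc) a

  ∷ʳ-congˡ : ∀ {N} {g h : Fin N → A} a → g ≗ h → (g ∷ʳ a) ≗ (h ∷ʳ a)
  ∷ʳ-congˡ {ℕ.zero} a g≗h _ = refl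
  ∷ʳ-congˡ {ℕ.suc N} a g≗h zero = g≗h zero
  ∷ʳ-congˡ {ℕ.suc N} a g≗h (suc x) = ∷ʳ-congˡ a (g≗h ∘ suc) x

sumMaps-∷ʳ : ∀ {k} N {w : (Fin (ℕ.suc N) → Fin k) → ℕ} → w Preserves _≗_ ⟶ _≡_ →
             sumMaps k (ℕ.suc N) w ≡ sumMaps k N (λ g → ∑[ i < k ] w (g ∷ʳ i))
sumMaps-∷ʳ {k} ℕ.zero w-≗ = sum-cong-≗ {k} λ i → w-≗ λ { zero → refl }
sumMaps-∷ʳ {k} (ℕ.suc N) {w} w-≗ = sum-cong-≗ {k} λ j → trans
  (sumMaps-∷ʳ N (∷-preserves-≗ w-≗ j))
  (sumMaps-cong N λ g → sum-cong-≗ {k} λ i → w-≗ λ { zero → refl ; (suc x) → refl })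

sumMaps-inject₁ : ∀ {k} N {w : (Fin N → Fin (ℕ.suc k)) → ℕ} {v : (Fin N → Fin k) → ℕ} →
                  w Preserves _≗_ ⟶ _≡_ →
                  (∀ g → (∃ λ x → g x ≡ fromℕ k) → w g ≡ 0) →
                  (∀ g → w (inject₁ ∘ g) ≡ v g) →
                  sumMaps (ℕ.suc k) N w ≡ sumMaps k N v
sumMaps-inject₁ ℕ.zero w-≗ _ w∘inject₁ = trans (w-≗ λ ()) (w∘inject₁ _)
sumMaps-inject₁ {k} (ℕ.suc N) {w} {v} w-≗ w-top w∘inject₁ = begin
  ∑[ i < ℕ.suc k ] sumMaps (ℕ.suc k) N (λ g → w (i ∷ g))
    ≡⟨ sum-init-last (λ i → sumMaps (ℕ.suc k) N (λ g → w (i ∷ g))) ⟩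
  ∑[ j < k ] sumMaps (ℕ.suc k) N (λ g → w (inject₁ j ∷ g)) + sumMaps (ℕ.suc k) N (λ g → w (fromℕ k ∷ g))
    ≡⟨ cong₂ _+_ (sum-cong-≗ λ j → sumMaps-inject₁ N (∷-preserves-≗ w-≗ (inject₁ j))
                                     (λ g (x , gx≡top) → w-top _ (suc x , gx≡top))
                                     (λ g → trans (w-≗ λ { zero → refl ; (suc x) → refl }) (w∘inject₁ (j ∷ g))))
                 (sumMaps-zero N λ g → w-top _ (zero , refl)) ⟩
  ∑[ j < k ] sumMaps k N (λ g → v (j ∷ g)) + 0
    ≡⟨ ℕP.+-identityʳ _ ⟩
  sumMaps k (ℕ.suc N) v ∎
  where open ≡-Reasoning

length-filter-∷ : ∀ {A : Set} {ℓ} {P : Pred A ℓ} (P? : Decidable P) x xs →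
                  length (filter P? (x List.∷ xs)) ≡ 𝟙 (P? x) + length (filter P? xs)
length-filter-∷ P? x xs with does (P? x)
... | true = refl
... | false = refl

length-filter-map : ∀ {A B : Set} {ℓ} {P : Pred A ℓ} (P? : Decidable P) (h : B → A) xs →
                    length (filter P? (List.map h xs)) ≡ length (filter (P? ∘ h) xs)
length-filter-map P? h List.[] = refl
length-filter-map P? h (x List.∷ xs) = begin
  length (filter P? (h x List.∷ List.map h xs))    ≡⟨ length-filter-∷ P? (h x) (List.map h xs) ⟩
  𝟙 (P? (h x)) + length (filter P? (List.map h xs)) ≡⟨ cong (_+_ (𝟙 (P? (h x)))) (length-filter-map P? h xs) ⟩
  𝟙 (P? (h x)) + length (filter (P? ∘ h) xs)        ≡⟨ length-filter-∷ (P? ∘ h) x xs ⟨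
  length (filter (P? ∘ h) (x List.∷ xs))           ∎
  where open ≡-Reasoning

length-filter-concatMap-tabulate :
  ∀ {A B : Set} {ℓ} {P : Pred A ℓ} (P? : Decidable P) {k} (f : B → List A) (g : Fin k → B) →
  length (filter P? (List.concatMap f (List.tabulate g))) ≡ ∑[ i < k ] length (filter P? (f (g i)))
length-filter-concatMap-tabulate P? {ℕ.zero} f g = refl
length-filter-concatMap-tabulate P? {ℕ.suc k} f g = begin
  length (filter P? (f (g zero) List.++ List.concatMap f (List.tabulate (g ∘ suc))))
    ≡⟨ cong length (ListP.filter-++ P? (f (g zero)) _) ⟩
  length (filter P? (f (g zero)) List.++ filter P? (List.concatMap f (List.tabulate (g ∘ suc))))
    ≡⟨ ListP.length-++ (filter P? (f (g zero))) ⟩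
  length (filter P? (f (g zero))) + length (filter P? (List.concatMap f (List.tabulate (g ∘ suc))))
    ≡⟨ cong (_+_ (length (filter P? (f (g zero))))) (length-filter-concatMap-tabulate P? f (g ∘ suc)) ⟩
  ∑[ i < ℕ.suc k ] length (filter P? (f (g i))) ∎
  where open ≡-Reasoning

length-filter-allVecs : ∀ {k} N {ℓ} {P : Pred (Vec.Vec (Fin k) N) ℓ} (P? : Decidable P) {w} →
                        w Preserves _≗_ ⟶ _≡_ → (∀ v → 𝟙 (P? v) ≡ w (Vec.lookup v)) →
                        length (filter P? (allVecs k N)) ≡ sumMaps k N w
length-filter-allVecs ℕ.zero P? w-≗ 𝟙≡w =
  trans (length-filter-∷ P? Vec.[] List.[]) (trans (ℕP.+-identityʳ _) (trans (𝟙≡w Vec.[]) (w-≗ λ ())))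
length-filter-allVecs {k} (ℕ.suc N) P? {w} w-≗ 𝟙≡w = begin
  length (filter P? (List.concatMap (λ i → List.map (i Vec.∷_) (allVecs k N)) (List.allFin k)))
    ≡⟨ length-filter-concatMap-tabulate P? (λ i → List.map (i Vec.∷_) (allVecs k N)) (λ i → i) ⟩
  ∑[ i < k ] length (filter P? (List.map (i Vec.∷_) (allVecs k N)))
    ≡⟨ sum-cong-≗ {k} (λ i → trans (length-filter-map P? (i Vec.∷_) (allVecs k N))
                                   (length-filter-allVecs N (P? ∘ (i Vec.∷_)) (∷-preserves-≗ w-≗ i)
                                     λ v → trans (𝟙≡w (i Vec.∷ v)) (w-≗ λ { zero → refl ; (suc x) → refl }))) ⟩
  sumMaps k (ℕ.suc N) w ∎
  where open ≡-Reasoning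

-- Constraint systems

module _ {m n} {i : Fin m} {j : Fin n} where

  inject₁-mono-< : i F.< j → inject₁ i F.< inject₁ j
  inject₁-mono-< = subst₂ ℕ._<_ (sym (FP.toℕ-inject₁ i)) (sym (FP.toℕ-inject₁ j))

  inject₁-cancel-< : inject₁ i F.< inject₁ j → i F.< j
  inject₁-cancel-< = subst₂ ℕ._<_ (FP.toℕ-inject₁ i) (FP.toℕ-inject₁ j)

inject₁<fromℕ : ∀ {n} (i : Fin n) → inject₁ i F.< fromℕ n
inject₁<fromℕ {n} i = subst (toℕ (inject₁ i) ℕ.<_) (sym (FP.toℕ-fromℕ n)) (FP.inject₁ℕ< i)

fromℕ≮ : ∀ {n} (i : Fin (ℕ.suc n)) → ¬ fromℕ n F.< i
fromℕ≮ i = ℕP.≤⇒≯ (FP.≤fromℕ i)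

-- x ↝ y: y may not share a block with x. For T(R₁,…,R_p), x = min Rᵢ and y ∈ Rᵢ ∖ {x}.
record Constraints (N : ℕ) : Set₁ where
  infix 4 _↝_ _↝?_
  field
    _↝_ : Fin N → Fin N → Set
    _↝?_ : ∀ x y → Dec (x ↝ y)
    ↝⇒< : ∀ {x y} → x ↝ y → x F.< y
    ↝-functional : ∀ {x x′ y} → x ↝ y → x′ ↝ y → x ≡ x′

module _ {N} (S : Constraints N) where
  open Constraints S

  Separates : ∀ {k} → (Fin N → Fin k) → Set
  Separates f = ∀ x y → x ↝ y → f y ≢ f x

  Compatible : ∀ {k} → (Fin N → Fin k) → Set
  Compatible f = IsCanonical f × IsSurjective f × Separates f

  compatible? : ∀ {k} (f : Fin N → Fin k) → Dec (Compatible f)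
  compatible? f =
    (all? λ x → all? λ j → (j F.<? f x) →-dec any? (λ y → (y F.<? x) ×-dec (f y ≟ j)))
    ×-dec ((all? λ j → any? λ x → f x ≟ j)
    ×-dec (all? λ x → all? λ y → (x ↝? y) →-dec ¬? (f y ≟ f x)))

  compatible-resp-≗ : ∀ {k} {f g : Fin N → Fin k} → f ≗ g → Compatible f → Compatible g
  compatible-resp-≗ f≗g (canonical , surjective , separates) =
    (λ x j j<gx → let (y , y<x , fy≡j) = canonical x j (subst (j F.<_) (sym (f≗g x)) j<gx)
                  in y , y<x , trans (sym (f≗g y)) fy≡j) ,
    (λ j → let (x , fx≡j) = surjective j in x , trans (sym (f≗g x)) fx≡j) ,
    (λ x y x↝y gy≡gx → separates x y x↝y (trans (f≗g y) (trans gy≡gx (sym (f≗g x)))))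

  𝟙-compatible-preserves-≗ : ∀ {k} → (λ (f : Fin N → Fin k) → 𝟙 (compatible? f)) Preserves _≗_ ⟶ _≡_
  𝟙-compatible-preserves-≗ f≗g =
    𝟙-cong (mk⇔ (compatible-resp-≗ f≗g) (compatible-resp-≗ (sym ∘ f≗g))) (compatible? _) (compatible? _)

  stirling : ℕ → ℕ
  stirling k = sumMaps k N (λ f → 𝟙 (compatible? f))

  #constrained : ℕ
  #constrained = ∑[ y < N ] 𝟙 (any? λ x → x ↝? y)

restrict : ∀ {N} → Constraints (ℕ.suc N) → Constraints N
restrict S = record
  { _↝_ = λ x y → inject₁ x ↝ inject₁ y
  ; _↝?_ = λ x y → inject₁ x ↝? inject₁ y
  ; ↝⇒< = inject₁-cancel-< ∘ ↝⇒<
  ; ↝-functional = λ c c′ → FP.inject₁-injective (↝-functional c c′)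
  }
  where open Constraints S

inject₁∘-canonical : ∀ {N k} {g : Fin N → Fin k} → IsCanonical g ⇔ IsCanonical (inject₁ ∘ g)
inject₁∘-canonical {g = g} = mk⇔ to from
  where
  to : IsCanonical g → IsCanonical (inject₁ ∘ g)
  to canonical x j j<gx with view j
  ... | ‵fromℕ = contradiction j<gx (fromℕ≮ _)
  ... | ‵inject₁ j′ = let (y , y<x , gy≡j′) = canonical x j′ (inject₁-cancel-< j<gx) in y , y<x , cong inject₁ gy≡j′

  from : IsCanonical (inject₁ ∘ g) → IsCanonical g
  from canonical x j j<gx = let (y , y<x , gy≡j) = canonical x (inject₁ j) (inject₁-mono-< j<gx)
                            in y , y<x , FP.inject₁-injective gy≡j

module _ {N} (S : Constraints (ℕ.suc N)) where
  open Constraints S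

  private
    S′ = restrict S

  LastConstrained : Set
  LastConstrained = ∃ λ x → inject₁ x ↝ fromℕ N

  lastConstrained? : Dec LastConstrained
  lastConstrained? = any? λ x → inject₁ x ↝? fromℕ N

  constrained⇔constrained-by-inject₁ : ∀ {y} → (∃ λ x → x ↝ y) ⇔ (∃ λ x → inject₁ x ↝ y)
  constrained⇔constrained-by-inject₁ {y} = mk⇔ to (λ (x , c) → inject₁ x , c)
    where
    to : (∃ λ x → x ↝ y) → ∃ λ x → inject₁ x ↝ y
    to (x , x↝y) with view x
    ... | ‵fromℕ = contradiction (↝⇒< x↝y) (fromℕ≮ y)
    ... | ‵inject₁ x′ = x′ , x↝y

  #constrained-restrict : #constrained S ≡ #constrained (restrict S) + 𝟙 lastConstrained?
  #constrained-restrict = trans (sum-init-last (λ y → 𝟙 (any? λ x → x ↝? y))) (cong₂ _+_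
    (sum-cong-≗ {N} λ y → 𝟙-cong constrained⇔constrained-by-inject₁
                                 (any? λ x → x ↝? inject₁ y) (any? λ x → inject₁ x ↝? inject₁ y))
    (𝟙-cong constrained⇔constrained-by-inject₁ (any? λ x → x ↝? fromℕ N) lastConstrained?))


  HitsTop : ∀ {k} → (Fin N → Fin (ℕ.suc k)) → Set
  HitsTop {k} g = ∃ λ x → g x ≡ fromℕ k

  hitsTop? : ∀ {k} (g : Fin N → Fin (ℕ.suc k)) → Dec (HitsTop g)
  hitsTop? {k} g = any? λ x → g x ≟ fromℕ k

  Avoids : ∀ {k} → (Fin N → Fin k) → Fin k → Set
  Avoids g i = ∀ x → inject₁ x ↝ fromℕ N → i ≢ g x

  avoids? : ∀ {k} (g : Fin N → Fin k) i → Dec (Avoids g i)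
  avoids? g i = all? λ x → (inject₁ x ↝? fromℕ N) →-dec ¬? (i ≟ g x)

  compatible-∷ʳ⁻ : ∀ {k} {g : Fin N → Fin k} {i} → Compatible S (g ∷ʳ i) →
                   IsCanonical g × Separates S′ g × Avoids g i
  compatible-∷ʳ⁻ {g = g} {i} (canonical , _ , separates) = canonical′ , separates′ , avoids
    where
    canonical′ : IsCanonical g
    canonical′ x j j<gx with canonical (inject₁ x) j (subst (j F.<_) (sym (init-∷ʳ g i x)) j<gx)
    ... | y , y<x , fy≡j with view y
    ... | ‵fromℕ = contradiction y<x (fromℕ≮ _)
    ... | ‵inject₁ y′ = y′ , inject₁-cancel-< y<x , trans (sym (init-∷ʳ g i y′)) fy≡j

    separates′ : Separates S′ g
    separates′ x y x↝y gy≡gx =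
      separates (inject₁ x) (inject₁ y) x↝y (trans (init-∷ʳ g i y) (trans gy≡gx (sym (init-∷ʳ g i x))))

    avoids : Avoids g i
    avoids x x↝last i≡gx =
      separates (inject₁ x) (fromℕ N) x↝last (trans (last-∷ʳ g i) (trans i≡gx (sym (init-∷ʳ g i x))))

  compatible-∷ʳ⁺ : ∀ {k} {g : Fin N → Fin k} {i} → IsCanonical g → Separates S′ g → Avoids g i →
                   (∀ j → j ≢ i → ∃ λ y → g y ≡ j) → Compatible S (g ∷ʳ i)
  compatible-∷ʳ⁺ {g = g} {i} canonical separates avoids covers = canonical′ , surjective , separates′
    where
    canonical′ : IsCanonical (g ∷ʳ i)
    canonical′ x j j<fx with view x
    ... | ‵fromℕ = let (y , gy≡j) = covers j (FP.<⇒≢ (subst (j F.<_) (last-∷ʳ g i) j<fx))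
                   in inject₁ y , inject₁<fromℕ y , trans (init-∷ʳ g i y) gy≡j
    ... | ‵inject₁ x′ = let (y , y<x , gy≡j) = canonical x′ j (subst (j F.<_) (init-∷ʳ g i x′) j<fx)
                        in inject₁ y , inject₁-mono-< y<x , trans (init-∷ʳ g i y) gy≡j

    surjective : IsSurjective (g ∷ʳ i)
    surjective j with j ≟ i
    ... | yes refl = fromℕ N , last-∷ʳ g i
    ... | no j≢i = let (y , gy≡j) = covers j j≢i in inject₁ y , trans (init-∷ʳ g i y) gy≡j

    separates′ : Separates S (g ∷ʳ i)
    separates′ x y x↝y fy≡fx with view x | view y
    ... | ‵fromℕ | _ = contradiction (↝⇒< x↝y) (fromℕ≮ y)
    ... | ‵inject₁ x′ | ‵fromℕ =
      avoids x′ x↝y (trans (sym (last-∷ʳ g i)) (trans fy≡fx (init-∷ʳ g i x′)))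
    ... | ‵inject₁ x′ | ‵inject₁ y′ =
      separates x′ y′ x↝y (trans (sym (init-∷ʳ g i y′)) (trans fy≡fx (init-∷ʳ g i x′)))

  canonical∧hitsTop⇒surjective : ∀ {k} {g : Fin N → Fin (ℕ.suc k)} → IsCanonical g → HitsTop g → IsSurjective g
  canonical∧hitsTop⇒surjective canonical (x , gx≡top) j with view j
  ... | ‵fromℕ = x , gx≡top
  ... | ‵inject₁ j′ =
    let (y , _ , gy≡j) = canonical x (inject₁ j′) (subst (inject₁ j′ F.<_) (sym gx≡top) (inject₁<fromℕ j′))
    in y , gy≡j

  hitsTop⇒compatible-∷ʳ⇔ : ∀ {k} {g : Fin N → Fin (ℕ.suc k)} {i} → HitsTop g →
                      Compatible S (g ∷ʳ i) ⇔ (Compatible S′ g × Avoids g i)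
  hitsTop⇒compatible-∷ʳ⇔ hits = mk⇔
    (λ compatible → let (canonical , separates , avoids) = compatible-∷ʳ⁻ compatible
                    in (canonical , canonical∧hitsTop⇒surjective canonical hits , separates) , avoids)
    (λ ((canonical , surjective , separates) , avoids) →
      compatible-∷ʳ⁺ canonical separates avoids (λ j _ → surjective j))

  compatible-inject₁∘-∷ʳ-fromℕ⇔ : ∀ {k} {g : Fin N → Fin k} →
                                  Compatible S ((inject₁ ∘ g) ∷ʳ fromℕ k) ⇔ Compatible S′ g
  compatible-inject₁∘-∷ʳ-fromℕ⇔ {k} {g} = mk⇔ to from
    where
    to : Compatible S ((inject₁ ∘ g) ∷ʳ fromℕ k) → Compatible S′ g
    to compatible@(_ , surjective , _) =
      Equivalence.from inject₁∘-canonical canonical , surjective′ , λ x y x↝y → separates x y x↝y ∘ cong inject₁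
      where
      canonical = proj₁ (compatible-∷ʳ⁻ compatible)
      separates = proj₁ (proj₂ (compatible-∷ʳ⁻ compatible))
      surjective′ : IsSurjective g
      surjective′ j with surjective (inject₁ j)
      ... | x , fx≡j with view x
      ... | ‵fromℕ = contradiction (trans (sym (last-∷ʳ (inject₁ ∘ g) _)) fx≡j) FP.fromℕ≢inject₁
      ... | ‵inject₁ x′ = x′ , FP.inject₁-injective (trans (sym (init-∷ʳ (inject₁ ∘ g) _ x′)) fx≡j)

    from : Compatible S′ g → Compatible S ((inject₁ ∘ g) ∷ʳ fromℕ k)
    from (canonical , surjective , separates) =
      compatible-∷ʳ⁺ (Equivalence.to inject₁∘-canonical canonical)
                     (λ x y x↝y → separates x y x↝y ∘ FP.inject₁-injective)
                     (λ _ _ → FP.fromℕ≢inject₁)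
                     covers
      where
      covers : ∀ j → j ≢ fromℕ k → ∃ λ y → inject₁ (g y) ≡ j
      covers j j≢top with view j
      ... | ‵fromℕ = contradiction refl j≢top
      ... | ‵inject₁ j′ = let (y , gy≡j′) = surjective j′ in y , cong inject₁ gy≡j′

  ¬hitsTop⇒¬compatible-∷ʳ-inject₁ : ∀ {k} {g : Fin N → Fin (ℕ.suc k)} {j} →
                                    ¬ HitsTop g → ¬ Compatible S (g ∷ʳ inject₁ j)
  ¬hitsTop⇒¬compatible-∷ʳ-inject₁ {k} {g} {j} misses (_ , surjective , _) with surjective (fromℕ k)
  ... | x , fx≡top with view x
  ... | ‵fromℕ = FP.fromℕ≢inject₁ (trans (sym fx≡top) (last-∷ʳ g _))
  ... | ‵inject₁ x′ = misses (x′ , trans (sym (init-∷ʳ g _ x′)) fx≡top)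

  ∑-avoids : ∀ {k} (g : Fin N → Fin (ℕ.suc k)) → ∑[ i < ℕ.suc k ] 𝟙 (avoids? g i) ≡ ℕ.suc k ∸ 𝟙 (lastConstrained?)
  ∑-avoids {k} g with lastConstrained?
  ... | yes (x₀ , x₀↝last) =
    trans (sum-cong-≗ {ℕ.suc k} λ i → 𝟙-cong avoids⇔ (avoids? g i) (¬? (i ≟ g x₀))) (∑-𝟙-≢ (g x₀))
    where
    avoids⇔ : ∀ {i} → Avoids g i ⇔ (i ≢ g x₀)
    avoids⇔ = mk⇔ (λ avoids → avoids x₀ x₀↝last)
                  (λ i≢gx₀ x x↝last i≡gx →
                     i≢gx₀ (trans i≡gx (cong g (FP.inject₁-injective (↝-functional x↝last x₀↝last)))))
  ... | no unconstrained =
    trans (sum-cong-≗ {ℕ.suc k} λ i → 𝟙-yes (λ x x↝last → contradiction (x , x↝last) unconstrained) (avoids? g i))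
          (∑-1 (ℕ.suc k))

  OpensNewBlock : ∀ {k} → (Fin N → Fin (ℕ.suc k)) → Set
  OpensNewBlock {k} g = Compatible S (g ∷ʳ fromℕ k) × ¬ HitsTop g

  opensNewBlock? : ∀ {k} (g : Fin N → Fin (ℕ.suc k)) → Dec (OpensNewBlock g)
  opensNewBlock? {k} g = compatible? S (g ∷ʳ fromℕ k) ×-dec ¬? (hitsTop? g)

  opensNewBlock-resp-≗ : ∀ {k} {g h : Fin N → Fin (ℕ.suc k)} → g ≗ h → OpensNewBlock g → OpensNewBlock h
  opensNewBlock-resp-≗ g≗h (compatible , misses) =
    compatible-resp-≗ S (∷ʳ-congˡ _ g≗h) compatible , λ (x , hx≡top) → misses (x , trans (g≗h x) hx≡top)

  ∑-compatible-∷ʳ : ∀ {k} (g : Fin N → Fin (ℕ.suc k)) →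
                    ∑[ i < ℕ.suc k ] 𝟙 (compatible? S (g ∷ʳ i))
                      ≡ (ℕ.suc k ∸ 𝟙 (lastConstrained?)) ℕ.* 𝟙 (compatible? S′ g) + 𝟙 (opensNewBlock? g)
  ∑-compatible-∷ʳ {k} g = case hitsTop? g of λ where
      (yes hits) → whenHits hits
      (no misses) → whenMisses misses
    where
    open ≡-Reasoning
    c = ℕ.suc k ∸ 𝟙 (lastConstrained?)
    old = 𝟙 (compatible? S′ g)

    whenHits : HitsTop g → ∑[ i < ℕ.suc k ] 𝟙 (compatible? S (g ∷ʳ i)) ≡ c ℕ.* old + 𝟙 (opensNewBlock? g)
    whenHits hits = begin
      ∑[ i < ℕ.suc k ] 𝟙 (compatible? S (g ∷ʳ i))
        ≡⟨ sum-cong-≗ {ℕ.suc k} (λ i → trans (𝟙-cong (hitsTop⇒compatible-∷ʳ⇔ hits)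
                                                     (compatible? S (g ∷ʳ i)) (compatible? S′ g ×-dec avoids? g i))
                                             (𝟙-× (compatible? S′ g) (avoids? g i))) ⟩
      ∑[ i < ℕ.suc k ] (old ℕ.* 𝟙 (avoids? g i))
        ≡⟨ sym (*-distribˡ-sum old (λ i → 𝟙 (avoids? g i))) ⟩
      old ℕ.* ∑[ i < ℕ.suc k ] 𝟙 (avoids? g i)
        ≡⟨ trans (cong (old ℕ.*_) (∑-avoids g)) (ℕP.*-comm old c) ⟩
      c ℕ.* old
        ≡⟨ sym (ℕP.+-identityʳ _) ⟩
      c ℕ.* old + 0
        ≡⟨ cong (λ t → c ℕ.* old + t) (sym (𝟙-no (λ (_ , misses) → misses hits) (opensNewBlock? g))) ⟩
      c ℕ.* old + 𝟙 (opensNewBlock? g) ∎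

    whenMisses : ¬ HitsTop g → ∑[ i < ℕ.suc k ] 𝟙 (compatible? S (g ∷ʳ i)) ≡ c ℕ.* old + 𝟙 (opensNewBlock? g)
    whenMisses misses = begin
      ∑[ i < ℕ.suc k ] 𝟙 (compatible? S (g ∷ʳ i))
        ≡⟨ sum-init-last (λ i → 𝟙 (compatible? S (g ∷ʳ i))) ⟩
      ∑[ j < k ] 𝟙 (compatible? S (g ∷ʳ inject₁ j)) + 𝟙 (compatible? S (g ∷ʳ fromℕ k))
        ≡⟨ cong₂ _+_ (∑-zero k λ j → 𝟙-no (¬hitsTop⇒¬compatible-∷ʳ-inject₁ misses) (compatible? S (g ∷ʳ inject₁ j)))
                     (𝟙-cong (mk⇔ (_, misses) proj₁) (compatible? S (g ∷ʳ fromℕ k))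
                                                      (opensNewBlock? g)) ⟩
      0 + 𝟙 (opensNewBlock? g)
        ≡⟨ cong (_+ 𝟙 (opensNewBlock? g)) (sym (trans (cong (c ℕ.*_) old≡0) (ℕP.*-zeroʳ c))) ⟩
      c ℕ.* old + 𝟙 (opensNewBlock? g) ∎
      where
      old≡0 : old ≡ 0
      old≡0 = 𝟙-no (λ (_ , surjective , _) → misses (surjective (fromℕ k))) (compatible? S′ g)

  sumMaps-opensNewBlock : ∀ k → sumMaps (ℕ.suc k) N (𝟙 ∘ opensNewBlock?) ≡ stirling S′ k
  sumMaps-opensNewBlock k = sumMaps-inject₁ N 𝟙-opensNewBlock-preserves-≗
    (λ g hits → 𝟙-no (λ (_ , misses) → misses hits) (opensNewBlock? g))
    (λ g → 𝟙-cong (mk⇔ (Equivalence.to compatible-inject₁∘-∷ʳ-fromℕ⇔ ∘ proj₁)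
                       (λ compatible → Equivalence.from compatible-inject₁∘-∷ʳ-fromℕ⇔ compatible , inject₁∘-misses g))
                  (opensNewBlock? (inject₁ ∘ g))
                  (compatible? S′ g))
    where
    inject₁∘-misses : (g : Fin N → Fin k) → ¬ HitsTop (inject₁ ∘ g)
    inject₁∘-misses g (x , gx≡top) = FP.fromℕ≢inject₁ (sym gx≡top)

    𝟙-opensNewBlock-preserves-≗ : (𝟙 ∘ opensNewBlock? {k}) Preserves _≗_ ⟶ _≡_
    𝟙-opensNewBlock-preserves-≗ {g} {h} g≗h =
      𝟙-cong (mk⇔ (opensNewBlock-resp-≗ g≗h) (opensNewBlock-resp-≗ (sym ∘ g≗h))) (opensNewBlock? g) (opensNewBlock? h)

  stirling-suc : ∀ k → stirling S (ℕ.suc k) ≡ (ℕ.suc k ∸ 𝟙 lastConstrained?) ℕ.* stirling S′ (ℕ.suc k) + stirling S′ k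
  stirling-suc k = begin
    sumMaps (ℕ.suc k) (ℕ.suc N) (λ f → 𝟙 (compatible? S f))
      ≡⟨ sumMaps-∷ʳ N (𝟙-compatible-preserves-≗ S) ⟩
    sumMaps (ℕ.suc k) N (λ g → ∑[ i < ℕ.suc k ] 𝟙 (compatible? S (g ∷ʳ i)))
      ≡⟨ sumMaps-cong N ∑-compatible-∷ʳ ⟩
    sumMaps (ℕ.suc k) N (λ g → c ℕ.* 𝟙 (compatible? S′ g) + 𝟙 (opensNewBlock? g))
      ≡⟨ sumMaps-+ N _ (𝟙 ∘ opensNewBlock?) ⟩
    sumMaps (ℕ.suc k) N (λ g → c ℕ.* 𝟙 (compatible? S′ g)) + sumMaps (ℕ.suc k) N (𝟙 ∘ opensNewBlock?)
      ≡⟨ cong₂ _+_ (sumMaps-*ˡ N c _) (sumMaps-opensNewBlock k) ⟩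
    c ℕ.* stirling S′ (ℕ.suc k) + stirling S′ k ∎
    where
    open ≡-Reasoning
    c = ℕ.suc k ∸ 𝟙 (lastConstrained?)

stirling-empty : (S : Constraints 0) → stirling S 0 ≡ 1
stirling-empty S = 𝟙-yes ((λ ()) , (λ ()) , (λ ())) (compatible? S {k = 0} (λ ()))

stirling-vanishes : ∀ {N} (S : Constraints N) {k} → N ℕ.< k → stirling S k ≡ 0
stirling-vanishes {ℕ.zero} S {ℕ.suc k} _ =
  𝟙-no (λ (_ , surjective , _) → FP.¬Fin0 (proj₁ (surjective zero))) (compatible? S {k = ℕ.suc k} (λ ()))
stirling-vanishes {ℕ.suc N} S {ℕ.suc k} (ℕ.s≤s N<k) = begin
  stirling S (ℕ.suc k)
    ≡⟨ stirling-suc S k ⟩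
  c ℕ.* stirling (restrict S) (ℕ.suc k) + stirling (restrict S) k
    ≡⟨ cong₂ (λ s t → c ℕ.* s + t) (stirling-vanishes (restrict S) (ℕP.m<n⇒m<1+n N<k))
                                   (stirling-vanishes (restrict S) N<k) ⟩
  c ℕ.* 0 + 0
    ≡⟨ trans (ℕP.+-identityʳ _) (ℕP.*-zeroʳ c) ⟩
  0 ∎
  where
  open ≡-Reasoning
  c = ℕ.suc k ∸ 𝟙 (lastConstrained? S)

-- Falling factorials

sumTo-cong : ∀ n {f g : ℕ → ℤ} → (∀ k → f k ≡ g k) → sumTo n f ≡ sumTo n g
sumTo-cong ℕ.zero f≗g = f≗g 0
sumTo-cong (ℕ.suc n) f≗g = cong₂ ℤ._+_ (sumTo-cong n f≗g) (f≗g (ℕ.suc n))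

sumTo-sucˡ : ∀ n (f : ℕ → ℤ) → sumTo (ℕ.suc n) f ≡ f 0 ℤ.+ sumTo n (f ∘ ℕ.suc)
sumTo-sucˡ ℕ.zero f = refl
sumTo-sucˡ (ℕ.suc n) f = trans (cong (ℤ._+ f (ℕ.suc (ℕ.suc n))) (sumTo-sucˡ n f)) (ℤP.+-assoc (f 0) _ _)

sumTo-+ : ∀ n (f g : ℕ → ℤ) → sumTo n (λ k → f k ℤ.+ g k) ≡ sumTo n f ℤ.+ sumTo n g
sumTo-+ ℕ.zero f g = refl
sumTo-+ (ℕ.suc n) f g =
  trans (cong (ℤ._+ (f (ℕ.suc n) ℤ.+ g (ℕ.suc n))) (sumTo-+ n f g))
        (interchange (sumTo n f) (sumTo n g) (f (ℕ.suc n)) (g (ℕ.suc n)))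
  where
  interchange : ∀ a b c d → a ℤ.+ b ℤ.+ (c ℤ.+ d) ≡ a ℤ.+ c ℤ.+ (b ℤ.+ d)
  interchange = solve-∀

sumTo-*ʳ : ∀ n (f : ℕ → ℤ) c → sumTo n (λ k → f k * c) ≡ sumTo n f * c
sumTo-*ʳ ℕ.zero f c = refl
sumTo-*ʳ (ℕ.suc n) f c =
  trans (cong (ℤ._+ f (ℕ.suc n) * c) (sumTo-*ʳ n f c)) (sym (ℤP.*-distribʳ-+ c (sumTo n f) (f (ℕ.suc n))))

sumTo-shift : ∀ n (f : ℕ → ℤ) → f 0 ≡ + 0 → f (ℕ.suc n) ≡ + 0 → sumTo n (f ∘ ℕ.suc) ≡ sumTo n f
sumTo-shift n f f₀≡0 fₙ₊₁≡0 = begin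
  sumTo n (f ∘ ℕ.suc)             ≡⟨ ℤP.+-identityˡ _ ⟨
  + 0 ℤ.+ sumTo n (f ∘ ℕ.suc)     ≡⟨ cong (ℤ._+ sumTo n (f ∘ ℕ.suc)) f₀≡0 ⟨
  f 0 ℤ.+ sumTo n (f ∘ ℕ.suc)     ≡⟨ sumTo-sucˡ n f ⟨
  sumTo n f ℤ.+ f (ℕ.suc n)       ≡⟨ cong (ℤ._+_ (sumTo n f)) fₙ₊₁≡0 ⟩
  sumTo n f ℤ.+ + 0               ≡⟨ ℤP.+-identityʳ _ ⟩
  sumTo n f                       ∎
  where open ≡-Reasoning

falling-1+ : ∀ z k → falling (+ 1 ℤ.+ z) (ℕ.suc k) ≡ (+ 1 ℤ.+ z) * falling z k
falling-1+ z ℕ.zero = solve-∀′ z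
  where
  solve-∀′ : ∀ z → + 1 * ((+ 1 ℤ.+ z) - + 0) ≡ (+ 1 ℤ.+ z) * + 1
  solve-∀′ = solve-∀
falling-1+ z (ℕ.suc k) = trans (cong (_* ((+ 1 ℤ.+ z) - + ℕ.suc k)) (falling-1+ z k)) (regroup z (falling z k) (+ k))
  where
  regroup : ∀ z φ k → (+ 1 ℤ.+ z) * φ * ((+ 1 ℤ.+ z) - (+ 1 ℤ.+ k)) ≡ (+ 1 ℤ.+ z) * (φ * (z - k))
  regroup = solve-∀

falling-0 : ∀ k → falling (+ 0) (ℕ.suc k) ≡ + 0
falling-0 ℕ.zero = refl
falling-0 (ℕ.suc k) = cong (_* (+ 0 - + ℕ.suc k)) (falling-0 k)

-- (z)ₖ₊₁ = (z)ₖ (z − k), and the terms (k − δ) a′ₖ (z)ₖ telescope after reindexing.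
falling-expansion-step : ∀ N (a a′ : ℕ → ℤ) (δ z : ℤ) →
                         a 0 ≡ + 0 → δ * a′ 0 ≡ + 0 → a′ (ℕ.suc N) ≡ + 0 →
                         (∀ k → a (ℕ.suc k) ≡ (+ ℕ.suc k - δ) * a′ (ℕ.suc k) ℤ.+ a′ k) →
                         sumTo (ℕ.suc N) (λ k → a k * falling z k) ≡ sumTo N (λ k → a′ k * falling z k) * (z - δ)
falling-expansion-step N a a′ δ z a₀≡0 δa′₀≡0 a′ₙ₊₁≡0 recurrence = begin
  sumTo (ℕ.suc N) (λ k → a k * φ k)
    ≡⟨ sumTo-sucˡ N (λ k → a k * φ k) ⟩
  a 0 * + 1 ℤ.+ sumTo N (λ k → a (ℕ.suc k) * φ (ℕ.suc k))
    ≡⟨ cong₂ ℤ._+_ (cong (_* + 1) a₀≡0) (sumTo-cong N split) ⟩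
  + 0 ℤ.+ sumTo N (λ k → G (ℕ.suc k) ℤ.+ a′ k * φ (ℕ.suc k))
    ≡⟨ ℤP.+-identityˡ _ ⟩
  sumTo N (λ k → G (ℕ.suc k) ℤ.+ a′ k * φ (ℕ.suc k))
    ≡⟨ sumTo-+ N (G ∘ ℕ.suc) (λ k → a′ k * φ (ℕ.suc k)) ⟩
  sumTo N (G ∘ ℕ.suc) ℤ.+ sumTo N (λ k → a′ k * φ (ℕ.suc k))
    ≡⟨ cong (ℤ._+ sumTo N (λ k → a′ k * φ (ℕ.suc k))) (sumTo-shift N G G₀≡0 Gₙ₊₁≡0) ⟩
  sumTo N G ℤ.+ sumTo N (λ k → a′ k * φ (ℕ.suc k))
    ≡⟨ sumTo-+ N G (λ k → a′ k * φ (ℕ.suc k)) ⟨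
  sumTo N (λ k → G k ℤ.+ a′ k * φ (ℕ.suc k))
    ≡⟨ sumTo-cong N (λ k → regroup (a′ k) (φ k) z (+ k) δ) ⟩
  sumTo N (λ k → a′ k * φ k * (z - δ))
    ≡⟨ sumTo-*ʳ N (λ k → a′ k * φ k) (z - δ) ⟩
  sumTo N (λ k → a′ k * φ k) * (z - δ) ∎
  where
  open ≡-Reasoning
  φ = falling z

  G : ℕ → ℤ
  G k = (+ k - δ) * a′ k * φ k

  split : ∀ k → a (ℕ.suc k) * φ (ℕ.suc k) ≡ G (ℕ.suc k) ℤ.+ a′ k * φ (ℕ.suc k)
  split k = trans (cong (_* φ (ℕ.suc k)) (recurrence k))
                  (distribute (+ ℕ.suc k - δ) (a′ (ℕ.suc k)) (a′ k) (φ (ℕ.suc k)))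
    where
    distribute : ∀ c b b′ x → (c * b ℤ.+ b′) * x ≡ c * b * x ℤ.+ b′ * x
    distribute = solve-∀

  G₀≡0 : G 0 ≡ + 0
  G₀≡0 = trans (negate δ (a′ 0)) (cong ℤ.-_ δa′₀≡0)
    where
    negate : ∀ δ b → (+ 0 - δ) * b * + 1 ≡ ℤ.- (δ * b)
    negate = solve-∀

  Gₙ₊₁≡0 : G (ℕ.suc N) ≡ + 0
  Gₙ₊₁≡0 = trans (cong (λ b → (+ ℕ.suc N - δ) * b * φ (ℕ.suc N)) a′ₙ₊₁≡0)
                 (annihilate (+ ℕ.suc N - δ) (φ (ℕ.suc N)))
    where
    annihilate : ∀ c x → c * + 0 * x ≡ + 0
    annihilate = solve-∀

  regroup : ∀ b φ z k δ → (k - δ) * b * φ ℤ.+ b * (φ * (z - k)) ≡ b * φ * (z - δ)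
  regroup = solve-∀

stirlingPoly : ∀ {N} → Constraints N → ℤ → ℤ
stirlingPoly {N} S z = sumTo N (λ k → + stirling S k * falling z k)

stirlingPoly-restrict : ∀ {N} (S : Constraints (ℕ.suc N)) z →
                        stirlingPoly S z ≡ stirlingPoly (restrict S) z * (z - + 𝟙 (lastConstrained? S))
stirlingPoly-restrict {N} S z =
  falling-expansion-step N (λ k → + stirling S k) (λ k → + stirling (restrict S) k) (+ δ) z
                         refl (δ*stirling-restrict-0 N S)
    (cong +_ (stirling-vanishes (restrict S) (ℕP.n<1+n N))) recurrence
  where
  δ = 𝟙 (lastConstrained? S)

  δ*stirling-restrict-0 : ∀ N (S : Constraints (ℕ.suc N)) →
                          + 𝟙 (lastConstrained? S) * + stirling (restrict S) 0 ≡ + 0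
  δ*stirling-restrict-0 ℕ.zero S = refl
  δ*stirling-restrict-0 (ℕ.suc N) S = ℤP.*-zeroʳ (+ 𝟙 (lastConstrained? S))

  recurrence : ∀ k → + stirling S (ℕ.suc k)
                       ≡ (+ ℕ.suc k - + δ) * + stirling (restrict S) (ℕ.suc k) ℤ.+ + stirling (restrict S) k
  recurrence k = begin
    + stirling S (ℕ.suc k)
      ≡⟨ cong +_ (stirling-suc S k) ⟩
    + ((ℕ.suc k ∸ δ) ℕ.* stirling (restrict S) (ℕ.suc k) + stirling (restrict S) k)
      ≡⟨ ℤP.pos-+ ((ℕ.suc k ∸ δ) ℕ.* stirling (restrict S) (ℕ.suc k)) (stirling (restrict S) k) ⟩
    + ((ℕ.suc k ∸ δ) ℕ.* stirling (restrict S) (ℕ.suc k)) ℤ.+ + stirling (restrict S) k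
      ≡⟨ cong (ℤ._+ + stirling (restrict S) k) (ℤP.pos-* (ℕ.suc k ∸ δ) _) ⟩
    + (ℕ.suc k ∸ δ) * + stirling (restrict S) (ℕ.suc k) ℤ.+ + stirling (restrict S) k
      ≡⟨ cong (λ c → c * + stirling (restrict S) (ℕ.suc k) ℤ.+ + stirling (restrict S) k) pos-∸ ⟩
    (+ ℕ.suc k - + δ) * + stirling (restrict S) (ℕ.suc k) ℤ.+ + stirling (restrict S) k ∎
    where
    open ≡-Reasoning
    pos-∸ : + (ℕ.suc k ∸ δ) ≡ + ℕ.suc k - + δ
    pos-∸ = sym (trans (ℤP.m-n≡m⊖n (ℕ.suc k) δ)
                       (ℤP.⊖-≥ (ℕP.≤-trans (𝟙≤1 (lastConstrained? S)) (ℕ.s≤s ℕ.z≤n))))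

powers-step : ∀ z {N B δ} → B ℕ.≤ N → δ ℕ.≤ 1 →
              z ^ (N ∸ B) * (z - + 1) ^ B * (z - + δ) ≡ z ^ (ℕ.suc N ∸ (B + δ)) * (z - + 1) ^ (B + δ)
powers-step z {N} {B} B≤N ℕ.z≤n = begin
  z ^ (N ∸ B) * (z - + 1) ^ B * (z - + 0)
    ≡⟨ rearrange (z ^ (N ∸ B)) ((z - + 1) ^ B) z ⟩
  z ^ ℕ.suc (N ∸ B) * (z - + 1) ^ B
    ≡⟨ cong₂ (λ e f → z ^ e * (z - + 1) ^ f)
             (sym (trans (cong (ℕ.suc N ∸_) (ℕP.+-identityʳ B)) (ℕP.+-∸-assoc 1 B≤N)))
             (sym (ℕP.+-identityʳ B)) ⟩
  z ^ (ℕ.suc N ∸ (B + 0)) * (z - + 1) ^ (B + 0) ∎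
  where
  open ≡-Reasoning
  rearrange : ∀ x y z → x * y * (z - + 0) ≡ z * x * y
  rearrange = solve-∀
powers-step z {N} {B} B≤N (ℕ.s≤s ℕ.z≤n) = begin
  z ^ (N ∸ B) * (z - + 1) ^ B * (z - + 1)
    ≡⟨ rearrange (z ^ (N ∸ B)) ((z - + 1) ^ B) (z - + 1) ⟩
  z ^ (ℕ.suc N ∸ ℕ.suc B) * (z - + 1) ^ ℕ.suc B
    ≡⟨ cong (λ e → z ^ (ℕ.suc N ∸ e) * (z - + 1) ^ e) (ℕP.+-comm 1 B) ⟩
  z ^ (ℕ.suc N ∸ (B + 1)) * (z - + 1) ^ (B + 1) ∎
  where
  open ≡-Reasoning
  rearrange : ∀ x y w → x * y * w ≡ x * (w * y)
  rearrange = solve-∀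

stirlingPoly-closed : ∀ {N} (S : Constraints N) z →
                      stirlingPoly S z ≡ z ^ (N ∸ #constrained S) * (z - + 1) ^ #constrained S
stirlingPoly-closed {ℕ.zero} S z = cong (λ s → + s * + 1) (stirling-empty S)
stirlingPoly-closed {ℕ.suc N} S z = begin
  stirlingPoly S z
    ≡⟨ stirlingPoly-restrict S z ⟩
  stirlingPoly (restrict S) z * (z - + δ)
    ≡⟨ cong (_* (z - + δ)) (stirlingPoly-closed (restrict S) z) ⟩
  z ^ (N ∸ B) * (z - + 1) ^ B * (z - + δ)
    ≡⟨ powers-step z (∑-𝟙≤ (λ y → any? λ x → Constraints._↝?_ (restrict S) x y)) (𝟙≤1 (lastConstrained? S)) ⟩
  z ^ (ℕ.suc N ∸ (B + δ)) * (z - + 1) ^ (B + δ)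
    ≡⟨ cong (λ e → z ^ (ℕ.suc N ∸ e) * (z - + 1) ^ e) (#constrained-restrict S) ⟨
  z ^ (ℕ.suc N ∸ #constrained S) * (z - + 1) ^ #constrained S ∎
  where
  open ≡-Reasoning
  δ = 𝟙 (lastConstrained? S)
  B = #constrained (restrict S)

sumTo-falling-0 : ∀ N (a : ℕ → ℤ) → sumTo N (λ k → a k * falling (+ 0) k) ≡ a 0
sumTo-falling-0 ℕ.zero a = ℤP.*-identityʳ (a 0)
sumTo-falling-0 (ℕ.suc N) a = begin
  sumTo N (λ k → a k * falling (+ 0) k) ℤ.+ a (ℕ.suc N) * falling (+ 0) (ℕ.suc N)
    ≡⟨ cong₂ ℤ._+_ (sumTo-falling-0 N a) (trans (cong (a (ℕ.suc N) *_) (falling-0 N)) (ℤP.*-zeroʳ (a (ℕ.suc N)))) ⟩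
  a 0 ℤ.+ + 0
    ≡⟨ ℤP.+-identityʳ (a 0) ⟩
  a 0 ∎
  where open ≡-Reasoning

-- At 0 only a₀ survives; at 1 + m, (1 + m)ₖ₊₁ = (1 + m) (m)ₖ lets one cancel 1 + m and recurse.
falling-coefficients-unique : ∀ N (a b : ℕ → ℤ) →
                              (∀ m → sumTo N (λ k → a k * falling (+ m) k) ≡ sumTo N (λ k → b k * falling (+ m) k)) →
                              ∀ {k} → k ℕ.≤ N → a k ≡ b k
falling-coefficients-unique N a b same {ℕ.zero} _ =
  trans (sym (sumTo-falling-0 N a)) (trans (same 0) (sumTo-falling-0 N b))
falling-coefficients-unique (ℕ.suc N) a b same {ℕ.suc k} (ℕ.s≤s k≤N) =
  falling-coefficients-unique N (a ∘ ℕ.suc) (b ∘ ℕ.suc) same-tail k≤N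
  where
  expand : ∀ (c : ℕ → ℤ) m → sumTo (ℕ.suc N) (λ k → c k * falling (+ ℕ.suc m) k)
                              ≡ c 0 * + 1 ℤ.+ sumTo N (λ k → c (ℕ.suc k) * falling (+ m) k) * + ℕ.suc m
  expand c m = trans (sumTo-sucˡ N _) (cong (ℤ._+_ (c 0 * + 1)) (trans
    (sumTo-cong N λ k → trans (cong (c (ℕ.suc k) *_) (falling-1+ (+ m) k)) (swap (c (ℕ.suc k)) _ _))
    (sumTo-*ʳ N (λ k → c (ℕ.suc k) * falling (+ m) k) (+ ℕ.suc m))))
    where
    swap : ∀ x y w → x * (y * w) ≡ x * w * y
    swap = solve-∀

  same-tail : ∀ m → sumTo N (λ k → a (ℕ.suc k) * falling (+ m) k) ≡ sumTo N (λ k → b (ℕ.suc k) * falling (+ m) k)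
  same-tail m = ℤP.*-cancelʳ-≡ _ _ (+ ℕ.suc m) (∙-cancelˡ (a 0 * + 1) _ _ (begin
    a 0 * + 1 ℤ.+ sumTo N (λ k → a (ℕ.suc k) * falling (+ m) k) * + ℕ.suc m
      ≡⟨ expand a m ⟨
    sumTo (ℕ.suc N) (λ k → a k * falling (+ ℕ.suc m) k)
      ≡⟨ same (ℕ.suc m) ⟩
    sumTo (ℕ.suc N) (λ k → b k * falling (+ ℕ.suc m) k)
      ≡⟨ expand b m ⟩
    b 0 * + 1 ℤ.+ sumTo N (λ k → b (ℕ.suc k) * falling (+ m) k) * + ℕ.suc m
      ≡⟨ cong (λ c → c * + 1 ℤ.+ sumTo N (λ k → b (ℕ.suc k) * falling (+ m) k) * + ℕ.suc m)
              (falling-coefficients-unique (ℕ.suc N) a b same ℕ.z≤n) ⟨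
    a 0 * + 1 ℤ.+ sumTo N (λ k → b (ℕ.suc k) * falling (+ m) k) * + ℕ.suc m ∎))
    where open ≡-Reasoning

stirlingPoly≗⇒stirling≗ : ∀ {N} (S T : Constraints N) → (∀ z → stirlingPoly S z ≡ stirlingPoly T z) →
                          ∀ k → stirling S k ≡ stirling T k
stirlingPoly≗⇒stirling≗ {N} S T same k with k ℕP.≤? N
... | yes k≤N =
  ℤP.+-injective (falling-coefficients-unique N (λ k → + stirling S k) (λ k → + stirling T k) (same ∘ +_) k≤N)
... | no k≰N = trans (stirling-vanishes S (ℕP.≰⇒> k≰N)) (sym (stirling-vanishes T (ℕP.≰⇒> k≰N)))

-- The restrictions T(R₁,…,R_p)

IsLeast : ∀ {N} → Subset N → Fin N → Set
IsLeast S x = x ∈ S × (∀ y → y ∈ S → x F.≤ y)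

isLeast-unique : ∀ {N} {S : Subset N} {x x′} → IsLeast S x → IsLeast S x′ → x ≡ x′
isLeast-unique (x∈S , x≤) (x′∈S , x′≤) = FP.≤-antisym (x≤ _ x′∈S) (x′≤ _ x∈S)

least : ∀ {N} (S : Subset N) → 1 ℕ.≤ ∣ S ∣ → ∃ (IsLeast S)
least (true Vec.∷ S) _ = zero , here , λ _ _ → ℕ.z≤n
least (false Vec.∷ S) 1≤∣S∣ =
  let (m , m∈S , m≤) = least S 1≤∣S∣
  in suc m , there m∈S , λ { zero () ; (suc y) (there y∈S) → ℕ.s≤s (m≤ y y∈S) }

PairwiseDisjoint : ∀ {N p} → (Fin p → Subset N) → Set
PairwiseDisjoint R = ∀ i j → i ≢ j → ∀ x → x ∈ R i → x ∉ R j

singleton-disjoint : ∀ {N} {S : Subset N} → PairwiseDisjoint {p = 1} (λ _ → S)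
singleton-disjoint zero zero 0≢0 = contradiction refl 0≢0

fromSubsets : ∀ {N p} (R : Fin p → Subset N) → PairwiseDisjoint R → Constraints N
fromSubsets {N} R disjoint = record
  { _↝_ = Separated
  ; _↝?_ = λ x y → any? λ i → ((x ∈? R i) ×-dec all? (λ z → z ∈? R i →-dec x ≤? z)) ×-dec (y ∈? R i) ×-dec ¬? (y ≟ x)
  ; ↝⇒< = λ (_ , (_ , x≤) , y∈Rᵢ , y≢x) → FP.≤∧≢⇒< (x≤ _ y∈Rᵢ) (y≢x ∘ sym)
  ; ↝-functional = functional
  }
  where
  Separated : Fin N → Fin N → Set
  Separated x y = ∃ λ i → IsLeast (R i) x × y ∈ R i × y ≢ x

  functional : ∀ {x x′ y} → Separated x y → Separated x′ y → x ≡ x′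
  functional (i , x-least , y∈Rᵢ , _) (j , x′-least , y∈Rⱼ , _) with i ≟ j
  ... | yes refl = isLeast-unique x-least x′-least
  ... | no i≢j = contradiction y∈Rⱼ (disjoint i j i≢j _ y∈Rᵢ)

module _ {N p} (R : Fin p → Subset N) (disjoint : PairwiseDisjoint R) where
  private
    S = fromSubsets R disjoint
  open Constraints S

  admissible⇔compatible : ∀ {k} {f : Fin N → Fin k} → Admissible R f ⇔ Compatible S f
  admissible⇔compatible = mk⇔
    (λ (canonical , surjective , minSeparated) → canonical , surjective ,
       λ { x y (i , (x∈Rᵢ , x≤) , y∈Rᵢ , y≢x) → minSeparated i x x∈Rᵢ x≤ y y∈Rᵢ y≢x })
    (λ (canonical , surjective , separates) → canonical , surjective ,
       λ i x x∈Rᵢ x≤ y y∈Rᵢ y≢x → separates x y (i , (x∈Rᵢ , x≤) , y∈Rᵢ , y≢x))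

  StirlingT≡stirling : ∀ k → StirlingT N k R ≡ stirling S k
  StirlingT≡stirling k = length-filter-allVecs N (λ v → admissible? R (Vec.lookup v)) (𝟙-compatible-preserves-≗ S)
    λ v → 𝟙-cong admissible⇔compatible (admissible? R (Vec.lookup v)) (compatible? S (Vec.lookup v))

  #constrained-fromSubsets : (∀ i → 1 ℕ.≤ ∣ R i ∣) → #constrained S + p ≡ ∑[ i < p ] ∣ R i ∣
  #constrained-fromSubsets nonempty = begin
    ∑[ y < N ] 𝟙 (any? λ x → x ↝? y) + p
      ≡⟨ cong (_+ p) (sum-cong-≗ {N} λ y → trans (𝟙-cong constrained⇔ (any? λ x → x ↝? y) (any? λ i → inRᵢ∖mᵢ? i y))
                                                 (𝟙-any?-unique (λ i → inRᵢ∖mᵢ? i y) unique)) ⟩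
    ∑[ y < N ] ∑[ i < p ] 𝟙 (inRᵢ∖mᵢ? i y) + p
      ≡⟨ cong₂ _+_ (∑-comm (λ y i → 𝟙 (inRᵢ∖mᵢ? i y))) (sym (∑-1 p)) ⟩
    ∑[ i < p ] ∑[ y < N ] 𝟙 (inRᵢ∖mᵢ? i y) + ∑[ i < p ] 1
      ≡⟨ ∑-distrib-+ (λ i → ∑[ y < N ] 𝟙 (inRᵢ∖mᵢ? i y)) (λ _ → 1) ⟨
    ∑[ i < p ] (∑[ y < N ] 𝟙 (inRᵢ∖mᵢ? i y) + 1)
      ≡⟨ sum-cong-≗ {p} (λ i → ∑-𝟙-∈-≢ (R i) (proj₁ (m-least i))) ⟩
    ∑[ i < p ] ∣ R i ∣ ∎
    where
    open ≡-Reasoning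
    m : Fin p → Fin N
    m i = proj₁ (least (R i) (nonempty i))

    m-least : ∀ i → IsLeast (R i) (m i)
    m-least i = proj₂ (least (R i) (nonempty i))

    inRᵢ∖mᵢ? : ∀ i y → Dec (y ∈ R i × y ≢ m i)
    inRᵢ∖mᵢ? i y = y ∈? R i ×-dec ¬? (y ≟ m i)

    constrained⇔ : ∀ {y} → (∃ λ x → x ↝ y) ⇔ (∃ λ i → y ∈ R i × y ≢ m i)
    constrained⇔ = mk⇔
      (λ (x , i , x-least , y∈Rᵢ , y≢x) → i , y∈Rᵢ , λ y≡mᵢ → y≢x (trans y≡mᵢ (isLeast-unique (m-least i) x-least)))
      (λ (i , y∈Rᵢ , y≢mᵢ) → m i , i , m-least i , y∈Rᵢ , y≢mᵢ)

    unique : ∀ {y i j} → y ∈ R i × y ≢ m i → y ∈ R j × y ≢ m j → i ≡ j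
    unique {y} {i} {j} (y∈Rᵢ , _) (y∈Rⱼ , _) with i ≟ j
    ... | yes i≡j = i≡j
    ... | no i≢j = contradiction y∈Rⱼ (disjoint i j i≢j y y∈Rᵢ)

total≡∑ : ∀ {p} (r : Fin p → ℕ) → total r ≡ ∑[ i < p ] r i
total≡∑ {ℕ.zero} r = refl
total≡∑ {ℕ.suc p} r = cong (_+_ (r zero)) (total≡∑ (r ∘ suc))

mainTheorem9 :
    (p : ℕ) → 1 ℕ.≤ p →
    (r : Fin p → ℕ) → (∀ i → 1 ℕ.≤ r i) → (∀ i j → i F.≤ j → r i ℕ.≤ r j) →
    (n : ℕ) →
    (R : Fin p → Subset (n + total r)) →
    (∀ i → ∣ R i ∣ ≡ r i) →
    (∀ i j → i ≢ j → ∀ x → x ∈ R i → x ∉ R j) →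
    (S : Subset (n + total r)) → ∣ S ∣ ≡ total r ∸ p + 1 →
    ((z : ℤ) →
      z ^ (n + p) * (z - + 1) ^ (total r ∸ p)
        ≡ sumTo (n + total r) (λ k → + StirlingT (n + total r) k R * falling z k))
    × (∀ k → StirlingT (n + total r) k R ≡ StirlingT (n + total r) k {1} (λ _ → S))
mainTheorem9 p _ r 1≤r _ n R ∣R∣≡r disjoint S ∣S∣≡ = polynomial , coefficients
  where
  T = total r
  TR = fromSubsets R disjoint
  TS = fromSubsets (λ _ → S) singleton-disjoint

  #TR+p : #constrained TR + p ≡ T
  #TR+p = trans (#constrained-fromSubsets R disjoint λ i → subst (1 ℕ.≤_) (sym (∣R∣≡r i)) (1≤r i))
                (trans (sum-cong-≗ {p} ∣R∣≡r) (sym (total≡∑ r)))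

  #TS+1 : #constrained TS + 1 ≡ T ∸ p + 1
  #TS+1 = trans (#constrained-fromSubsets (λ _ → S) singleton-disjoint
                  λ _ → subst (1 ℕ.≤_) (sym ∣S∣≡) (ℕP.m≤n+m 1 (T ∸ p)))
                (trans (ℕP.+-identityʳ ∣ S ∣) ∣S∣≡)

  closed : ∀ Q → #constrained Q ≡ T ∸ p → ∀ z → stirlingPoly Q z ≡ z ^ (n + p) * (z - + 1) ^ (T ∸ p)
  closed Q #Q≡T∸p z = trans (stirlingPoly-closed Q z) (cong₂ (λ e f → z ^ e * (z - + 1) ^ f) exponent #Q≡T∸p)
    where
    exponent : n + T ∸ #constrained Q ≡ n + p
    exponent = trans (cong (n + T ∸_) #Q≡T∸p) (trans (ℕP.+-∸-assoc n (ℕP.m∸n≤m T p))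
                     (cong (_+_ n) (ℕP.m∸[m∸n]≡n (subst (p ℕ.≤_) #TR+p (ℕP.m≤n+m p _)))))

  closedR = closed TR (trans (sym (ℕP.m+n∸n≡m _ p)) (cong (_∸ p) #TR+p))
  closedS = closed TS (ℕP.+-cancelʳ-≡ 1 _ _ #TS+1)

  polynomial : ∀ z → z ^ (n + p) * (z - + 1) ^ (T ∸ p) ≡ sumTo (n + T) (λ k → + StirlingT (n + T) k R * falling z k)
  polynomial z = trans (sym (closedR z))
    (sumTo-cong (n + T) λ k → cong (λ s → + s * falling z k) (sym (StirlingT≡stirling R disjoint k)))

  coefficients : ∀ k → StirlingT (n + T) k R ≡ StirlingT (n + T) k (λ _ → S)
  coefficients k = trans (StirlingT≡stirling R disjoint k) (trans
    (stirlingPoly≗⇒stirling≗ TR TS (λ z → trans (closedR z) (sym (closedS z))) k)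
    (sym (StirlingT≡stirling (λ _ → S) singleton-disjoint k)))
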